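{- For every bivaluation $\rho$ for $LET_K^+$, the map $v_\rho:For(\Sigma)\to B_{LET_K}$ given by $v_\rho(A)=(\rho(A),\rho(\neg A),\rho(\circ A))$ is a valuation over the matrix $\mathcal{M}_6$, and for every formula $A$: $v_\rho(A)\in\mathrm{D}$ if and only if $\rho(A)=1$.
   Context: $For(\Sigma)$ is the set of formulas over a denumerable set of propositional variables and $\Sigma=\{\land,\lor,\to,\neg,\circ\}$. Let $\{0,1\}$ be the two-element Boolean algebra with $\sqcap,\sqcup,\sim$ and $a\Rightarrow b=\sim a\sqcup b$. $\mathcal{M}_6$ is the logical matrix with domain $B_{LET_K}=\{z\in\{0,1\}^3:z_3\le z_1\sqcup z_2,\ z_1\sqcap z_2\sqcap z_3=0\}=\{T=(1,0,1),T_0=(1,0,0),\mathsf{b}=(1,1,0),\mathsf{n}=(0,0,0),F_0=(0,1,0),F=(0,1,1)\}$, designated set $\mathrm{D}=\{T,T_0,\mathsf{b}\}$, and operations: $z\tilde\land w=(z_1\sqcap w_1,\ z_2\sqcup w_2,\ (z_1\sqcap z_3\sqcap w_1\sqcap w_3)\sqcup(z_2\sqcap z_3)\sqcup(w_2\sqcap w_3))$; $z\tilde\lor w=(z_1\sqcup w_1,\ z_2\sqcap w_2,\ (z_2\sqcap z_3\sqcap w_2\sqcap w_3)\sqcup(z_1\sqcap z_3)\sqcup(w_1\sqcap w_3))$; $z\tilde\to w=(z_1\Rightarrow w_1,\ z_1\sqcap w_2,\ (z_1\sqcap w_2\sqcap w_3)\sqcup(z_2\sqcap z_3)\sqcup(w_1\sqcap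 w_3))$; $\tilde\neg z=(z_2,z_1,z_3)$; $\tilde\circ z=(z_3,\sim z_3,1)$. A valuation over $\mathcal{M}_6$ is a homomorphism from the formula algebra into this algebra. A bivaluation for $LET_K$ is $\rho:For(\Sigma)\to\{0,1\}$ with: (v1) $\rho(A\land B)=1$ iff $\rho(A)=\rho(B)=1$; (v2) $\rho(A\lor B)=1$ iff $\rho(A)=1$ or $\rho(B)=1$; (v3) $\rho(A\to B)=1$ iff $\rho(A)=0$ or $\rho(B)=1$; (v4) $\rho(\neg\neg A)=1$ iff $\rho(A)=1$; (v5) $\rho(\neg(A\land B))=1$ iff $\rho(\neg A)=1$ or $\rho(\neg B)=1$; (v6) $\rho(\neg(A\lor B))=1$ iff $\rho(\neg A)=\rho(\neg B)=1$; (v7) $\rho(\neg(A\to B))=1$ iff $\rho(A)=\rho(\neg B)=1$; (v8) if $\rho(\circ A)=1$ then ($\rho(\neg A)=1$ iff $\rho(A)=0$). A bivaluation for $LET_K^+$ is a bivaluation for $LET_K$ satisfying moreover, for all $A,B$: (vp1) $\rho(\circ\circ A)=1$; (vp2) $\rho(\circ\neg A)=\rho(\circ A)$; (vp3) if $\rho(\circ A)=\rho(A)=1$ and $\rho(\circ B)=\rho(B)=1$ then $\rho(\circ(A\land B))=1$; (vp4) if $\rho(\circ A)=\rho(\neg A)=1$ then $\rho(\circ(A\land B))=1$; (vp5) if $\rho(\circ B)=\rho(\neg B)=1$ then $\rho(\circ(A\land B))=1$; (vp6) if $\rho(\circ(A\land B))=\rho(A)=\rho(B)=1$ then $\rho(\circ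 A)=\rho(\circ B)=1$; (vp7) if $\rho(\circ(A\land B))=1$ and ($\rho(\neg A)=1$ or $\rho(\neg B)=1$) then ($\rho(\circ A)=\rho(\neg A)=1$ or $\rho(\circ B)=\rho(\neg B)=1$); (vp8) if $\rho(\circ A)=\rho(A)=1$ then $\rho(\circ(A\lor B))=1$; (vp9) if $\rho(\circ B)=\rho(B)=1$ then $\rho(\circ(A\lor B))=1$; (vp10) if $\rho(\circ A)=\rho(\neg A)=1$ and $\rho(\circ B)=\rho(\neg B)=1$ then $\rho(\circ(A\lor B))=1$; (vp11) if $\rho(\circ(A\lor B))=1$ and ($\rho(A)=1$ or $\rho(B)=1$) then ($\rho(\circ A)=\rho(A)=1$ or $\rho(\circ B)=\rho(B)=1$); (vp12) if $\rho(\circ(A\lor B))=1$ and $\rho(A)=\rho(B)=0$ then $\rho(\circ A)=\rho(\circ B)=1$; (vp13) if $\rho(\circ A)=\rho(\neg A)=1$ then $\rho(\circ(A\to B))=1$; (vp14) if $\rho(\circ B)=\rho(B)=1$ then $\rho(\circ(A\to B))=1$; (vp15) if $\rho(A)=1$ and $\rho(\circ B)=\rho(\neg B)=1$ then $\rho(\circ(A\to B))=1$; (vp16) if $\rho(\circ(A\to B))=1$ and ($\rho(A)=0$ or $\rho(B)=1$) then ($\rho(\circ A)=\rho(\neg A)=1$ or $\rho(\circ B)=\rho(B)=1$); (vp17) if $\rho(\circ(A\to B))=1$ and $\rho(A)=\rho(\neg B)=1$ then $\rho(\circ B)=1$. -}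

module Defs where

open import Data.Nat using (ℕ)
open import Data.Bool using (Bool; true; false; _∧_; _∨_; not)
open import Data.Product using (_×_; _,_)
open import Data.Sum using (_⊎_)
open import Relation.Binary.PropositionalEquality using (_≡_)
open import Function.Bundles using (_⇔_)

data For : Set where
  var  : ℕ → For
  _∧'_ : For → For → For
  _∨'_ : For → For → For
  _⇒'_ : For → For → For
  ¬'_  : For → For
  ∘'_  : For → For

_⇒b_ : Bool → Bool → Bool
a ⇒b b = not a ∨ b

Triple : Set
Triple = Bool × Bool × Bool

-- membership in B_{LET_K}: z3 ≤ z1 ⊔ z2 and z1 ⊓ z2 ⊓ z3 = 0
InB : Triple → Set
InB (z1 , z2 , z3) = ((z3 ⇒b (z1 ∨ z2)) ≡ true) × ((z1 ∧ z2 ∧ z3) ≡ false)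

T T₀ 𝐛 𝐧 F₀ F : Triple
T  = (true , false , true)
T₀ = (true , false , false)
𝐛  = (true , true , false)
𝐧  = (false , false , false)
F₀ = (false , true , false)
F  = (false , true , true)

InD : Triple → Set
InD z = z ≡ T ⊎ z ≡ T₀ ⊎ z ≡ 𝐛

_∧̃_ : Triple → Triple → Triple
(z1 , z2 , z3) ∧̃ (w1 , w2 , w3) =
  (z1 ∧ w1 , z2 ∨ w2 , ((z1 ∧ z3 ∧ w1 ∧ w3) ∨ (z2 ∧ z3)) ∨ (w2 ∧ w3))

_∨̃_ : Triple → Triple → Triple
(z1 , z2 , z3) ∨̃ (w1 , w2 , w3) =
  (z1 ∨ w1 , z2 ∧ w2 , ((z2 ∧ z3 ∧ w2 ∧ w3) ∨ (z1 ∧ z3)) ∨ (w1 ∧ w3))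

_→̃_ : Triple → Triple → Triple
(z1 , z2 , z3) →̃ (w1 , w2 , w3) =
  (z1 ⇒b w1 , z1 ∧ w2 , ((z1 ∧ w2 ∧ w3) ∨ (z2 ∧ z3)) ∨ (w1 ∧ w3))

¬̃ : Triple → Triple
¬̃ (z1 , z2 , z3) = (z2 , z1 , z3)

∘̃ : Triple → Triple
∘̃ (z1 , z2 , z3) = (z3 , not z3 , true)

record IsValuation (v : For → Triple) : Set where
  field
    inB   : ∀ A → InB (v A)
    hom-∧ : ∀ A B → v (A ∧' B) ≡ v A ∧̃ v B
    hom-∨ : ∀ A B → v (A ∨' B) ≡ v A ∨̃ v B
    hom-→ : ∀ A B → v (A ⇒' B) ≡ v A →̃ v B
    hom-¬ : ∀ A → v (¬' A) ≡ ¬̃ (v A)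
    hom-∘ : ∀ A → v (∘' A) ≡ ∘̃ (v A)

record IsBivalLETK (ρ : For → Bool) : Set where
  field
    v1 : ∀ A B → (ρ (A ∧' B) ≡ true) ⇔ (ρ A ≡ true × ρ B ≡ true)
    v2 : ∀ A B → (ρ (A ∨' B) ≡ true) ⇔ (ρ A ≡ true ⊎ ρ B ≡ true)
    v3 : ∀ A B → (ρ (A ⇒' B) ≡ true) ⇔ (ρ A ≡ false ⊎ ρ B ≡ true)
    v4 : ∀ A → (ρ (¬' ¬' A) ≡ true) ⇔ (ρ A ≡ true)
    v5 : ∀ A B → (ρ (¬' (A ∧' B)) ≡ true) ⇔ (ρ (¬' A) ≡ true ⊎ ρ (¬' B) ≡ true)
    v6 : ∀ A B → (ρ (¬' (A ∨' B)) ≡ true) ⇔ (ρ (¬' A) ≡ true × ρ (¬' B) ≡ true)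
    v7 : ∀ A B → (ρ (¬' (A ⇒' B)) ≡ true) ⇔ (ρ A ≡ true × ρ (¬' B) ≡ true)
    v8 : ∀ A → ρ (∘' A) ≡ true → (ρ (¬' A) ≡ true) ⇔ (ρ A ≡ false)

record IsBivalLETKPlus (ρ : For → Bool) : Set where
  field
    base : IsBivalLETK ρ
    vp1  : ∀ A → ρ (∘' ∘' A) ≡ true
    vp2  : ∀ A → ρ (∘' ¬' A) ≡ ρ (∘' A)
    vp3  : ∀ A B → ρ (∘' A) ≡ true → ρ A ≡ true → ρ (∘' B) ≡ true → ρ B ≡ true →
           ρ (∘' (A ∧' B)) ≡ true
    vp4  : ∀ A B → ρ (∘' A) ≡ true → ρ (¬' A) ≡ true → ρ (∘' (A ∧' B)) ≡ true
    vp5  : ∀ A B → ρ (∘' B) ≡ true → ρ (¬' B) ≡ true → ρ (∘' (A ∧' B)) ≡ true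
    vp6  : ∀ A B → ρ (∘' (A ∧' B)) ≡ true → ρ A ≡ true → ρ B ≡ true →
           ρ (∘' A) ≡ true × ρ (∘' B) ≡ true
    vp7  : ∀ A B → ρ (∘' (A ∧' B)) ≡ true → (ρ (¬' A) ≡ true ⊎ ρ (¬' B) ≡ true) →
           (ρ (∘' A) ≡ true × ρ (¬' A) ≡ true) ⊎ (ρ (∘' B) ≡ true × ρ (¬' B) ≡ true)
    vp8  : ∀ A B → ρ (∘' A) ≡ true → ρ A ≡ true → ρ (∘' (A ∨' B)) ≡ true
    vp9  : ∀ A B → ρ (∘' B) ≡ true → ρ B ≡ true → ρ (∘' (A ∨' B)) ≡ true
    vp10 : ∀ A B → ρ (∘' A) ≡ true → ρ (¬' A) ≡ true → ρ (∘' B) ≡ true → ρ (¬' B) ≡ true →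
           ρ (∘' (A ∨' B)) ≡ true
    vp11 : ∀ A B → ρ (∘' (A ∨' B)) ≡ true → (ρ A ≡ true ⊎ ρ B ≡ true) →
           (ρ (∘' A) ≡ true × ρ A ≡ true) ⊎ (ρ (∘' B) ≡ true × ρ B ≡ true)
    vp12 : ∀ A B → ρ (∘' (A ∨' B)) ≡ true → ρ A ≡ false → ρ B ≡ false →
           ρ (∘' A) ≡ true × ρ (∘' B) ≡ true
    vp13 : ∀ A B → ρ (∘' A) ≡ true → ρ (¬' A) ≡ true → ρ (∘' (A ⇒' B)) ≡ true
    vp14 : ∀ A B → ρ (∘' B) ≡ true → ρ B ≡ true → ρ (∘' (A ⇒' B)) ≡ true
    vp15 : ∀ A B → ρ A ≡ true → ρ (∘' B) ≡ true → ρ (¬' B) ≡ true → ρ (∘' (A ⇒' B)) ≡ true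
    vp16 : ∀ A B → ρ (∘' (A ⇒' B)) ≡ true → (ρ A ≡ false ⊎ ρ B ≡ true) →
           (ρ (∘' A) ≡ true × ρ (¬' A) ≡ true) ⊎ (ρ (∘' B) ≡ true × ρ B ≡ true)
    vp17 : ∀ A B → ρ (∘' (A ⇒' B)) ≡ true → ρ A ≡ true → ρ (¬' B) ≡ true → ρ (∘' B) ≡ true

vρ : (For → Bool) → For → Triple
vρ ρ A = (ρ A , ρ (¬' A) , ρ (∘' A))

-- A bivaluation ρ induces vρ, and each clause of the bivaluation semantics is
-- exactly a truth-table clause of M₆: (v1)–(v7) give the first two coordinates of
-- vρ on compound formulas, (vp1)–(vp17) the third, and (v8) forces a "classical"
-- formula (∘A true) to have ρ(¬A) = not ρ(A), which places vρ(A) in B_{LET_K}.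
-- Every element of B_{LET_K} is designated precisely when its first coordinate is 1.
module Submission where

open import Defs
open import Data.Bool using (Bool; true; false; _∧_; _∨_; not)
open import Data.Bool.Properties using (T-≡; T-∧; T-∨; T-not-≡; ∨-conicalˡ; ∨-conicalʳ)
open import Data.Product using (_×_; _,_; proj₁; swap)
open import Data.Product.Function.NonDependent.Propositional using (_×-⇔_)
open import Data.Sum using (_⊎_; inj₁; inj₂; [_,_])
open import Data.Sum.Function.Propositional using (_⊎-⇔_)
open import Function using (_∘_)
open import Function.Bundles using (_⇔_; mk⇔; Equivalence)
import Function.Properties.Equivalence as ⇔
open import Relation.Binary.PropositionalEquality using (_≡_; refl; sym; trans; cong₂; subst)

private
  variable
    x y z w : Bool

≡-from-⇔ : (x ≡ true ⇔ y ≡ true) → x ≡ y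
≡-from-⇔ {true}          e = sym (Equivalence.to e refl)
≡-from-⇔ {false} {true}  e = Equivalence.from e refl
≡-from-⇔ {false} {false} _ = refl

∧-≡true : x ∧ y ≡ true ⇔ (x ≡ true × y ≡ true)
∧-≡true = ⇔.trans (⇔.sym T-≡) (⇔.trans T-∧ (T-≡ ×-⇔ T-≡))

∨-≡true : x ∨ y ≡ true ⇔ (x ≡ true ⊎ y ≡ true)
∨-≡true = ⇔.trans (⇔.sym T-≡) (⇔.trans T-∨ (T-≡ ⊎-⇔ T-≡))

not-≡true : not x ≡ true ⇔ x ≡ false
not-≡true = ⇔.trans (⇔.sym T-≡) T-not-≡

⇒b-≡true : x ⇒b y ≡ true ⇔ (x ≡ false ⊎ y ≡ true)
⇒b-≡true = ⇔.trans ∨-≡true (not-≡true ⊎-⇔ ⇔.refl)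

∧₃-≡true : x ∧ y ∧ z ≡ true ⇔ (x ≡ true × y ≡ true × z ≡ true)
∧₃-≡true = ⇔.trans ∧-≡true (⇔.refl ×-⇔ ∧-≡true)

∧₄-≡true : x ∧ y ∧ z ∧ w ≡ true ⇔ (x ≡ true × y ≡ true × z ≡ true × w ≡ true)
∧₄-≡true = ⇔.trans ∧-≡true (⇔.refl ×-⇔ ∧₃-≡true)

∨∨-≡true : (x ∨ y) ∨ z ≡ true ⇔ ((x ≡ true ⊎ y ≡ true) ⊎ z ≡ true)
∨∨-≡true = ⇔.trans ∨-≡true (∨-≡true ⊎-⇔ ⇔.refl)

triple-≡ : ∀ {a b c d e f : Bool} → a ≡ d → b ≡ e → c ≡ f → (a , b , c) ≡ (d , e , f)
triple-≡ p q r = cong₂ _,_ p (cong₂ _,_ q r)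

InB-consistent : ∀ a → InB (a , not a , true)
InB-consistent true  = refl , refl
InB-consistent false = refl , refl

InB-nonclassical : ∀ a b → InB (a , b , false)
InB-nonclassical true  true  = refl , refl
InB-nonclassical true  false = refl , refl
InB-nonclassical false b     = refl , refl

InD⇔proj₁≡true : ∀ {z} → InB z → InD z ⇔ (proj₁ z ≡ true)
InD⇔proj₁≡true {z} z∈B = mk⇔ first-true (designated z z∈B)
  where
  first-true : InD z → proj₁ z ≡ true
  first-true (inj₁ refl)        = refl
  first-true (inj₂ (inj₁ refl)) = refl
  first-true (inj₂ (inj₂ refl)) = refl

  designated : ∀ z → InB z → proj₁ z ≡ true → InD z
  designated (true , false , true)  _        refl = inj₁ refl
  designated (true , false , false) _        refl = inj₂ (inj₁ refl)
  designated (true , true  , false) _        refl = inj₂ (inj₂ refl)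
  designated (true , true  , true)  (_ , ()) refl
  designated (false , _ , _)        _        ()

module _ {ρ : For → Bool} (P : IsBivalLETKPlus ρ) where
  open IsBivalLETKPlus P
  open IsBivalLETK base
  open Equivalence

  ⊨_ : For → Set
  ⊨ A = ρ A ≡ true

  infix 4 ⊨_

  ρ-∧ : ∀ A B → ρ (A ∧' B) ≡ ρ A ∧ ρ B
  ρ-∧ A B = ≡-from-⇔ (⇔.trans (v1 A B) (⇔.sym ∧-≡true))

  ρ-∨ : ∀ A B → ρ (A ∨' B) ≡ ρ A ∨ ρ B
  ρ-∨ A B = ≡-from-⇔ (⇔.trans (v2 A B) (⇔.sym ∨-≡true))

  ρ-⇒ : ∀ A B → ρ (A ⇒' B) ≡ ρ A ⇒b ρ B
  ρ-⇒ A B = ≡-from-⇔ (⇔.trans (v3 A B) (⇔.sym ⇒b-≡true))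

  ρ-¬¬ : ∀ A → ρ (¬' ¬' A) ≡ ρ A
  ρ-¬¬ A = ≡-from-⇔ (v4 A)

  ρ-¬∧ : ∀ A B → ρ (¬' (A ∧' B)) ≡ ρ (¬' A) ∨ ρ (¬' B)
  ρ-¬∧ A B = ≡-from-⇔ (⇔.trans (v5 A B) (⇔.sym ∨-≡true))

  ρ-¬∨ : ∀ A B → ρ (¬' (A ∨' B)) ≡ ρ (¬' A) ∧ ρ (¬' B)
  ρ-¬∨ A B = ≡-from-⇔ (⇔.trans (v6 A B) (⇔.sym ∧-≡true))

  ρ-¬⇒ : ∀ A B → ρ (¬' (A ⇒' B)) ≡ ρ A ∧ ρ (¬' B)
  ρ-¬⇒ A B = ≡-from-⇔ (⇔.trans (v7 A B) (⇔.sym ∧-≡true))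

  ρ-¬-classical : ∀ {A} → ⊨ ∘' A → ρ (¬' A) ≡ not (ρ A)
  ρ-¬-classical {A} c = ≡-from-⇔ (⇔.trans (v8 A c) (⇔.sym not-≡true))

  ⊨∘-∧ : ∀ A B → ⊨ ∘' (A ∧' B) ⇔
           (((⊨ A × ⊨ ∘' A × ⊨ B × ⊨ ∘' B) ⊎ (⊨ ¬' A × ⊨ ∘' A)) ⊎ (⊨ ¬' B × ⊨ ∘' B))
  ⊨∘-∧ A B = mk⇔ classify recover
    where
    classify : ⊨ ∘' (A ∧' B) →
               ((⊨ A × ⊨ ∘' A × ⊨ B × ⊨ ∘' B) ⊎ (⊨ ¬' A × ⊨ ∘' A)) ⊎ (⊨ ¬' B × ⊨ ∘' B)
    classify c with ρ (A ∧' B) in A∧B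
    ... | true  = let a , b = to (v1 A B) A∧B ; ca , cb = vp6 A B c a b
                  in inj₁ (inj₁ (a , ca , b , cb))
    ... | false = [ inj₁ ∘ inj₂ ∘ swap , inj₂ ∘ swap ]
                    (vp7 A B c (to (v5 A B) (from (v8 (A ∧' B) c) A∧B)))

    recover : ((⊨ A × ⊨ ∘' A × ⊨ B × ⊨ ∘' B) ⊎ (⊨ ¬' A × ⊨ ∘' A)) ⊎ (⊨ ¬' B × ⊨ ∘' B) →
              ⊨ ∘' (A ∧' B)
    recover (inj₁ (inj₁ (a , ca , b , cb))) = vp3 A B ca a cb b
    recover (inj₁ (inj₂ (na , ca)))         = vp4 A B ca na
    recover (inj₂ (nb , cb))                = vp5 A B cb nb

  ⊨∘-∨ : ∀ A B → ⊨ ∘' (A ∨' B) ⇔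
           (((⊨ ¬' A × ⊨ ∘' A × ⊨ ¬' B × ⊨ ∘' B) ⊎ (⊨ A × ⊨ ∘' A)) ⊎ (⊨ B × ⊨ ∘' B))
  ⊨∘-∨ A B = mk⇔ classify recover
    where
    classify : ⊨ ∘' (A ∨' B) →
               ((⊨ ¬' A × ⊨ ∘' A × ⊨ ¬' B × ⊨ ∘' B) ⊎ (⊨ A × ⊨ ∘' A)) ⊎ (⊨ B × ⊨ ∘' B)
    classify c with ρ (A ∨' B) in A∨B
    ... | true  = [ inj₁ ∘ inj₂ ∘ swap , inj₂ ∘ swap ] (vp11 A B c (to (v2 A B) A∨B))
    ... | false =
      let A∨B≡false = trans (sym (ρ-∨ A B)) A∨B
          ca , cb = vp12 A B c (∨-conicalˡ _ _ A∨B≡false) (∨-conicalʳ _ _ A∨B≡false)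
          na , nb = to (v6 A B) (from (v8 (A ∨' B) c) A∨B)
      in inj₁ (inj₁ (na , ca , nb , cb))

    recover : ((⊨ ¬' A × ⊨ ∘' A × ⊨ ¬' B × ⊨ ∘' B) ⊎ (⊨ A × ⊨ ∘' A)) ⊎ (⊨ B × ⊨ ∘' B) →
              ⊨ ∘' (A ∨' B)
    recover (inj₁ (inj₁ (na , ca , nb , cb))) = vp10 A B ca na cb nb
    recover (inj₁ (inj₂ (a , ca)))            = vp8 A B ca a
    recover (inj₂ (b , cb))                   = vp9 A B cb b

  ⊨∘-⇒ : ∀ A B → ⊨ ∘' (A ⇒' B) ⇔
           (((⊨ A × ⊨ ¬' B × ⊨ ∘' B) ⊎ (⊨ ¬' A × ⊨ ∘' A)) ⊎ (⊨ B × ⊨ ∘' B))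
  ⊨∘-⇒ A B = mk⇔ classify recover
    where
    classify : ⊨ ∘' (A ⇒' B) →
               ((⊨ A × ⊨ ¬' B × ⊨ ∘' B) ⊎ (⊨ ¬' A × ⊨ ∘' A)) ⊎ (⊨ B × ⊨ ∘' B)
    classify c with ρ (A ⇒' B) in A⇒B
    ... | true  = [ inj₁ ∘ inj₂ ∘ swap , inj₂ ∘ swap ] (vp16 A B c (to (v3 A B) A⇒B))
    ... | false = let a , nb = to (v7 A B) (from (v8 (A ⇒' B) c) A⇒B)
                  in inj₁ (inj₁ (a , nb , vp17 A B c a nb))

    recover : ((⊨ A × ⊨ ¬' B × ⊨ ∘' B) ⊎ (⊨ ¬' A × ⊨ ∘' A)) ⊎ (⊨ B × ⊨ ∘' B) →
              ⊨ ∘' (A ⇒' B)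
    recover (inj₁ (inj₁ (a , nb , cb))) = vp15 A B a cb nb
    recover (inj₁ (inj₂ (na , ca)))     = vp13 A B ca na
    recover (inj₂ (b , cb))             = vp14 A B cb b

  ρ-∘∧ : ∀ A B → ρ (∘' (A ∧' B)) ≡
           ((ρ A ∧ ρ (∘' A) ∧ ρ B ∧ ρ (∘' B)) ∨ (ρ (¬' A) ∧ ρ (∘' A))) ∨ (ρ (¬' B) ∧ ρ (∘' B))
  ρ-∘∧ A B = ≡-from-⇔ (⇔.trans (⊨∘-∧ A B)
               (⇔.sym (⇔.trans ∨∨-≡true ((∧₄-≡true ⊎-⇔ ∧-≡true) ⊎-⇔ ∧-≡true))))

  ρ-∘∨ : ∀ A B → ρ (∘' (A ∨' B)) ≡
           ((ρ (¬' A) ∧ ρ (∘' A) ∧ ρ (¬' B) ∧ ρ (∘' B)) ∨ (ρ A ∧ ρ (∘' A))) ∨ (ρ B ∧ ρ (∘' B))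
  ρ-∘∨ A B = ≡-from-⇔ (⇔.trans (⊨∘-∨ A B)
               (⇔.sym (⇔.trans ∨∨-≡true ((∧₄-≡true ⊎-⇔ ∧-≡true) ⊎-⇔ ∧-≡true))))

  ρ-∘⇒ : ∀ A B → ρ (∘' (A ⇒' B)) ≡
           ((ρ A ∧ ρ (¬' B) ∧ ρ (∘' B)) ∨ (ρ (¬' A) ∧ ρ (∘' A))) ∨ (ρ B ∧ ρ (∘' B))
  ρ-∘⇒ A B = ≡-from-⇔ (⇔.trans (⊨∘-⇒ A B)
               (⇔.sym (⇔.trans ∨∨-≡true ((∧₃-≡true ⊎-⇔ ∧-≡true) ⊎-⇔ ∧-≡true))))

  vρ∈B : ∀ A → InB (vρ ρ A)
  vρ∈B A with ρ (∘' A) in c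
  ... | true  = subst (λ n → InB (ρ A , n , true)) (sym (ρ-¬-classical c)) (InB-consistent (ρ A))
  ... | false = InB-nonclassical (ρ A) (ρ (¬' A))

  vρ-isValuation : IsValuation (vρ ρ)
  vρ-isValuation = record
    { inB   = vρ∈B
    ; hom-∧ = λ A B → triple-≡ (ρ-∧ A B) (ρ-¬∧ A B) (ρ-∘∧ A B)
    ; hom-∨ = λ A B → triple-≡ (ρ-∨ A B) (ρ-¬∨ A B) (ρ-∘∨ A B)
    ; hom-→ = λ A B → triple-≡ (ρ-⇒ A B) (ρ-¬⇒ A B) (ρ-∘⇒ A B)
    ; hom-¬ = λ A → triple-≡ refl (ρ-¬¬ A) (vp2 A)
    ; hom-∘ = λ A → triple-≡ refl (ρ-¬-classical (vp1 A)) (vp1 A)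
    }

proposition3p14 : (ρ : For → Bool) → IsBivalLETKPlus ρ →
    IsValuation (vρ ρ) × (∀ A → InD (vρ ρ A) ⇔ (ρ A ≡ true))
proposition3p14 ρ P = vρ-isValuation P , λ A → InD⇔proj₁≡true (vρ∈B P A)
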